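{- Let $G$ be a finite simple graph with critical independent sets $I_c$ and $J_c$, let $J=J_c\setminus (I_c\cup N(I_c))$ and $I=I_c\cup J$. Then (1) $|I_c\cap N(J_c)|=|J_c\cap N(I_c)|$; (2) $|J|\ge |N(J_c)\setminus (I_c\cup N(I_c))|$; (3) $I$ is a critical independent set of $G$.
   Context: For $S\subseteq V(G)$, $N(S)=\bigcup_{u\in S}N(u)$. An independent set $K$ of $G$ is a critical independent set if $|K|-|N(K)|\ge |L|-|N(L)|$ for every independent set $L$ of $G$. -}

module Defs where

open import Data.Nat using (ℕ)
open import Data.Bool using (Bool; true; false; _∨_)
open import Data.Fin using (Fin)
open import Data.Fin.Subset using (Subset; _∈_; ∣_∣)
open import Data.Vec using (tabulate; lookup; foldr)
open import Data.Vec.Functional as VF using ()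
open import Data.Integer using (ℤ; +_; _-_; _≥_)
open import Relation.Binary.PropositionalEquality using (_≡_)
open import Data.Empty using (⊥)
open import Data.Product using (_×_)
import Data.Bool

record SimpleGraph (n : ℕ) : Set where
  field
    adj       : Fin n → Fin n → Bool
    symmetric : ∀ u v → adj u v ≡ adj v u
    loopless  : ∀ v → adj v v ≡ false

open SimpleGraph public

module _ {n : ℕ} (G : SimpleGraph n) where

  N : Subset n → Subset n
  N S = tabulate λ v → VF.foldr _∨_ false (λ u → Data.Bool._∧_ (lookup S u) (adj G u v))

  Independent : Subset n → Set
  Independent S = ∀ u v → u ∈ S → v ∈ S → adj G u v ≡ true → ⊥

  diff : Subset n → ℤ
  diff S = + ∣ S ∣ - + ∣ N S ∣

  CriticalIndependent : Subset n → Set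
  CriticalIndependent K =
    Independent K × (∀ L → Independent L → diff K ≥ diff L)

module Submission where

-- Write N[X] = X ∪ N(X) for the closed neighbourhood.  For a critical
-- independent set Y, comparing Y with a well-chosen independent subset
-- of itself yields a cardinality inequality; the three parts follow.
--   (1) Compare Y with Y ∖ N(X): since N(Y ∖ N(X)) misses X, this gives
--       |X ∩ N(Y)| ≤ |Y ∩ N(X)| for every X; applying it both ways to
--       two critical sets gives equality.
--   (2) Compare Y with Y ∩ X (X independent): N(Y ∩ X) lies in N(X) and
--       misses X, which gives
--       |X ∩ N(Y)| + |N(Y) ∖ N[X]| ≤ |Y ∩ N(X)| + |Y ∖ N[X]|,
--       and (1) cancels the first summands.
--   (3) I = X ∪ (Y ∖ N[X]) is independent, |I| = |X| + |Y ∖ N[X]| and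
--       N(I) ⊆ N(X) ∪ (N(Y) ∖ N[X]); by (2), |I| - |N(I)| ≥ |X| - |N(X)|,
--       so I is critical whenever X is.

open import Defs
open import Data.Nat using (ℕ; _≥_)
open import Data.Fin.Subset using (Subset; _∩_; _∪_; _─_; ∣_∣)
open import Data.Product using (_×_)
open import Relation.Binary.PropositionalEquality using (_≡_)

open import Data.Nat using (suc; _+_; _≤_)
open import Data.Nat.Properties
  using (+-suc; +-cancelˡ-≤; +-monoʳ-≤; +-monoˡ-≤; +-mono-≤; ≤-antisym; module ≤-Reasoning)
import Data.Nat.Tactic.RingSolver as ℕ-Ring
open import Data.Bool using (Bool; true; false; _∧_; _∨_)
open import Data.Bool.Properties using (∨-zeroʳ)
open import Data.Fin using (Fin; zero; suc)
open import Data.Fin.Subset using (_∈_; _∉_; _⊆_; inside; outside)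
open import Data.Fin.Subset.Properties
  using ( p⊆q⇒∣p∣≤∣q∣; p─q⊆p; p∩q⊆p; ∩-comm; x∈p∩q⁺; x∈p∩q⁻; x∈p∪q⁺; x∈p∪q⁻
        ; x∈p∧x∉q⇒x∈p─q; p─q─r≡p─q∪r; _∈?_)
open import Data.Vec using (_∷_; []; here; there)
open import Data.Vec.Properties using (lookup∘tabulate; lookup⇒[]=; []=⇒lookup)
import Data.Vec.Functional as VF
open import Data.Product using (∃; _,_; proj₁; proj₂)
open import Data.Sum using (inj₁; inj₂)
open import Data.Empty using (⊥)
import Data.Integer as ℤ
import Data.Integer.Properties as ℤ
open import Data.Integer.Tactic.RingSolver using (solve-∀)
open import Function using (_∘_)
open import Function.Bundles using (_⇔_; mk⇔; Equivalence)
open import Relation.Nullary using (yes; no; contradiction)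
open import Relation.Binary.PropositionalEquality
  using (refl; sym; trans; cong; cong₂; subst; subst₂)

∧-true⁻ : ∀ {a b : Bool} → a ∧ b ≡ true → a ≡ true × b ≡ true
∧-true⁻ {true} b≡true = refl , b≡true

⋁-true⁺ : ∀ {m} (f : Fin m → Bool) i → f i ≡ true → VF.foldr _∨_ false f ≡ true
⋁-true⁺ f zero    fi≡true = cong (_∨ VF.foldr _∨_ false (f ∘ suc)) fi≡true
⋁-true⁺ f (suc i) fi≡true =
  trans (cong (f zero ∨_) (⋁-true⁺ (f ∘ suc) i fi≡true)) (∨-zeroʳ (f zero))

⋁-true⁻ : ∀ {m} (f : Fin m → Bool) → VF.foldr _∨_ false f ≡ true → ∃ λ i → f i ≡ true
⋁-true⁻ {suc m} f ⋁≡true with f zero in f0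
... | true  = zero , f0
... | false with ⋁-true⁻ (f ∘ suc) ⋁≡true
...   | i , fi≡true = suc i , fi≡true

x∈p─q⁻ : ∀ {n} {x : Fin n} (p q : Subset n) → x ∈ p ─ q → x ∈ p × x ∉ q
x∈p─q⁻ p q x∈p─q = p─q⊆p p q x∈p─q , ∉q p q x∈p─q
  where
  ∉q : ∀ {n} {x : Fin n} (p q : Subset n) → x ∈ p ─ q → x ∉ q
  ∉q (_ ∷ p) (_      ∷ q) (there x∈p─q) (there x∈q) = ∉q p q x∈p─q x∈q
  ∉q (_ ∷ p) (inside ∷ q) ()            here

∣p∣≡∣p∩q∣+∣p─q∣ : ∀ {n} (p q : Subset n) → ∣ p ∣ ≡ ∣ p ∩ q ∣ + ∣ p ─ q ∣
∣p∣≡∣p∩q∣+∣p─q∣ []            []            = refl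
∣p∣≡∣p∩q∣+∣p─q∣ (outside ∷ p) (inside  ∷ q) = ∣p∣≡∣p∩q∣+∣p─q∣ p q
∣p∣≡∣p∩q∣+∣p─q∣ (outside ∷ p) (outside ∷ q) = ∣p∣≡∣p∩q∣+∣p─q∣ p q
∣p∣≡∣p∩q∣+∣p─q∣ (inside  ∷ p) (inside  ∷ q) = cong suc (∣p∣≡∣p∩q∣+∣p─q∣ p q)
∣p∣≡∣p∩q∣+∣p─q∣ (inside  ∷ p) (outside ∷ q) =
  trans (cong suc (∣p∣≡∣p∩q∣+∣p─q∣ p q)) (sym (+-suc _ _))

∣p∣≡∣p∩q∣+∣p─q∩r∣+∣p─q∪r∣ : ∀ {n} (p q r : Subset n) →
  ∣ p ∣ ≡ ∣ p ∩ q ∣ + (∣ (p ─ q) ∩ r ∣ + ∣ p ─ (q ∪ r) ∣)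
∣p∣≡∣p∩q∣+∣p─q∩r∣+∣p─q∪r∣ p q r = trans (∣p∣≡∣p∩q∣+∣p─q∣ p q)
  (cong (∣ p ∩ q ∣ +_) (trans (∣p∣≡∣p∩q∣+∣p─q∣ (p ─ q) r)
    (cong (λ s → ∣ (p ─ q) ∩ r ∣ + ∣ s ∣) (p─q─r≡p─q∪r p q r))))

∣p∪q∣≤∣p∣+∣q∣ : ∀ {n} (p q : Subset n) → ∣ p ∪ q ∣ ≤ ∣ p ∣ + ∣ q ∣
∣p∪q∣≤∣p∣+∣q∣ p q = subst (_≤ ∣ p ∣ + ∣ q ∣) (sym (∣p∣≡∣p∩q∣+∣p─q∣ (p ∪ q) p))
  (+-mono-≤ (p⊆q⇒∣p∣≤∣q∣ inter⊆p) (p⊆q⇒∣p∣≤∣q∣ rest⊆q))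
  where
  inter⊆p : (p ∪ q) ∩ p ⊆ p
  inter⊆p x∈ = proj₂ (x∈p∩q⁻ (p ∪ q) p x∈)
  rest⊆q : (p ∪ q) ─ p ⊆ q
  rest⊆q x∈ with x∈p─q⁻ (p ∪ q) p x∈
  ... | x∈p∪q , x∉p with x∈p∪q⁻ p q x∈p∪q
  ...   | inj₁ x∈p = contradiction x∈p x∉p
  ...   | inj₂ x∈q = x∈q

-- Cardinality is additive on disjoint subsets (one inequality suffices).
disjoint⇒∣p∣+∣q∣≤∣p∪q∣ : ∀ {n} (p q : Subset n) → (∀ {x} → x ∈ q → x ∉ p) →
  ∣ p ∣ + ∣ q ∣ ≤ ∣ p ∪ q ∣
disjoint⇒∣p∣+∣q∣≤∣p∪q∣ p q disjoint = subst (∣ p ∣ + ∣ q ∣ ≤_) (sym (∣p∣≡∣p∩q∣+∣p─q∣ (p ∪ q) p))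
  (+-mono-≤ (p⊆q⇒∣p∣≤∣q∣ p⊆inter) (p⊆q⇒∣p∣≤∣q∣ q⊆rest))
  where
  p⊆inter : p ⊆ (p ∪ q) ∩ p
  p⊆inter x∈p = x∈p∩q⁺ (x∈p∪q⁺ (inj₁ x∈p) , x∈p)
  q⊆rest : q ⊆ (p ∪ q) ─ p
  q⊆rest x∈q = x∈p∧x∉q⇒x∈p─q (x∈p∪q⁺ (inj₂ x∈q)) (disjoint x∈q)

-- Criticality compares integers |K| - |N(K)|; over ℕ this is an
-- inequality between cross sums.

i-j≤k-l⇔i+l≤k+j : ∀ i j k l → (i ℤ.- j ℤ.≤ k ℤ.- l) ⇔ (i ℤ.+ l ℤ.≤ k ℤ.+ j)
i-j≤k-l⇔i+l≤k+j i j k l = mk⇔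
  (λ le → subst₂ ℤ._≤_ (add i j l) (add′ k l j) (ℤ.+-monoˡ-≤ (j ℤ.+ l) le))
  (λ le → subst₂ ℤ._≤_ (sub i l j) (sub′ k j l) (ℤ.+-monoˡ-≤ (ℤ.- j ℤ.- l) le))
  where
  add : ∀ i j l → (i ℤ.- j) ℤ.+ (j ℤ.+ l) ≡ i ℤ.+ l
  add = solve-∀
  add′ : ∀ k l j → (k ℤ.- l) ℤ.+ (j ℤ.+ l) ≡ k ℤ.+ j
  add′ = solve-∀
  sub : ∀ i l j → (i ℤ.+ l) ℤ.+ (ℤ.- j ℤ.- l) ≡ i ℤ.- j
  sub = solve-∀
  sub′ : ∀ k j l → (k ℤ.+ j) ℤ.+ (ℤ.- j ℤ.- l) ≡ k ℤ.- l
  sub′ = solve-∀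

ℕ-diff-≤⇔ : ∀ a b c d → (ℤ.+ a ℤ.- ℤ.+ b ℤ.≤ ℤ.+ c ℤ.- ℤ.+ d) ⇔ (a + d ≤ c + b)
ℕ-diff-≤⇔ a b c d = mk⇔
  (λ le → ℤ.drop‿+≤+ (subst₂ ℤ._≤_ (sym (ℤ.pos-+ a d)) (sym (ℤ.pos-+ c b))
                        (Equivalence.to (i-j≤k-l⇔i+l≤k+j (ℤ.+ a) (ℤ.+ b) (ℤ.+ c) (ℤ.+ d)) le)))
  (λ le → Equivalence.from (i-j≤k-l⇔i+l≤k+j (ℤ.+ a) (ℤ.+ b) (ℤ.+ c) (ℤ.+ d))
            (subst₂ ℤ._≤_ (ℤ.pos-+ a d) (ℤ.pos-+ c b) (ℤ.+≤+ le)))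

module _ {n : ℕ} (G : SimpleGraph n) where

  N[_] : Subset n → Subset n
  N[ X ] = X ∪ N G X

  adj-sym : ∀ {u v} → adj G u v ≡ true → adj G v u ≡ true
  adj-sym {u} {v} uv = trans (symmetric G v u) uv

  N-intro : ∀ {S u v} → u ∈ S → adj G u v ≡ true → v ∈ N G S
  N-intro {S} {u} {v} u∈S uv = lookup⇒[]= v (N G S)
    (trans (lookup∘tabulate _ v) (⋁-true⁺ _ u (cong₂ _∧_ ([]=⇒lookup u∈S) uv)))

  N-elim : ∀ {S v} → v ∈ N G S → ∃ λ u → u ∈ S × adj G u v ≡ true
  N-elim {S} {v} v∈NS with ⋁-true⁻ _ (trans (sym (lookup∘tabulate _ v)) ([]=⇒lookup v∈NS))
  ... | u , u∧uv with ∧-true⁻ u∧uv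
  ...   | u∈S , uv = u , lookup⇒[]= u S u∈S , uv

  independent-⊆ : ∀ {S T} → S ⊆ T → Independent G T → Independent G S
  independent-⊆ S⊆T indT u v u∈S v∈S = indT u v (S⊆T u∈S) (S⊆T v∈S)

  ∉N[]⇒non-adjacent : ∀ {X u v} → u ∉ N[ X ] → v ∈ X → adj G u v ≡ true → ⊥
  ∉N[]⇒non-adjacent u∉ v∈X uv = u∉ (x∈p∪q⁺ (inj₂ (N-intro v∈X (adj-sym uv))))

  critical⇒≤ : ∀ {K L} → CriticalIndependent G K → Independent G L →
    ∣ L ∣ + ∣ N G K ∣ ≤ ∣ K ∣ + ∣ N G L ∣
  critical⇒≤ {K} {L} (_ , maximal) indL =
    Equivalence.to (ℕ-diff-≤⇔ (∣ L ∣) (∣ N G L ∣) (∣ K ∣) (∣ N G K ∣)) (maximal L indL)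

  -- Part (1), one direction: for critical Y and ANY vertex set X,
  -- |X ∩ N(Y)| ≤ |Y ∩ N(X)|.  Test Y against L = Y ∖ N(X), whose
  -- neighbourhood lies in N(Y) ∖ X.
  crossing-≤ : ∀ X Y → CriticalIndependent G Y → ∣ X ∩ N G Y ∣ ≤ ∣ Y ∩ N G X ∣
  crossing-≤ X Y critY = +-cancelˡ-≤ (∣ L ∣ + ∣ N G Y ─ X ∣) _ _ (begin
      ∣ L ∣ + ∣ N G Y ─ X ∣ + ∣ X ∩ N G Y ∣    ≡⟨ swap₂₃ (∣ L ∣) _ _ ⟩
      ∣ L ∣ + (∣ X ∩ N G Y ∣ + ∣ N G Y ─ X ∣)  ≡⟨ cong (∣ L ∣ +_) split-NY ⟩
      ∣ L ∣ + ∣ N G Y ∣                        ≤⟨ critical⇒≤ critY L-independent ⟩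
      ∣ Y ∣ + ∣ N G L ∣                        ≤⟨ +-monoʳ-≤ (∣ Y ∣) (p⊆q⇒∣p∣≤∣q∣ NL⊆NY─X) ⟩
      ∣ Y ∣ + ∣ N G Y ─ X ∣                    ≡⟨ cong (_+ ∣ N G Y ─ X ∣) (∣p∣≡∣p∩q∣+∣p─q∣ Y (N G X)) ⟩
      ∣ Y ∩ N G X ∣ + ∣ L ∣ + ∣ N G Y ─ X ∣    ≡⟨ rotate (∣ Y ∩ N G X ∣) _ _ ⟩
      ∣ L ∣ + ∣ N G Y ─ X ∣ + ∣ Y ∩ N G X ∣    ∎)
    where
    open ≤-Reasoning
    L : Subset n
    L = Y ─ N G X
    L-independent : Independent G L
    L-independent = independent-⊆ (p─q⊆p Y (N G X)) (proj₁ critY)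
    NL⊆NY─X : N G L ⊆ N G Y ─ X
    NL⊆NY─X v∈NL with N-elim v∈NL
    ... | u , u∈L , uv with x∈p─q⁻ Y (N G X) u∈L
    ...   | u∈Y , u∉NX = x∈p∧x∉q⇒x∈p─q (N-intro u∈Y uv) λ v∈X → u∉NX (N-intro v∈X (adj-sym uv))
    split-NY : ∣ X ∩ N G Y ∣ + ∣ N G Y ─ X ∣ ≡ ∣ N G Y ∣
    split-NY = sym (trans (∣p∣≡∣p∩q∣+∣p─q∣ (N G Y) X)
                          (cong (λ s → ∣ s ∣ + ∣ N G Y ─ X ∣) (∩-comm (N G Y) X)))
    swap₂₃ : ∀ a b c → a + b + c ≡ a + (c + b)
    swap₂₃ = ℕ-Ring.solve-∀
    rotate : ∀ a b c → a + b + c ≡ b + c + a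
    rotate = ℕ-Ring.solve-∀

  -- Test Y against
  -- K = Y ∩ X; as X is independent, N(K) lies in M = (N(Y) ∖ X) ∩ N(X),
  -- and splitting Y and N(Y) along X and N(X) exhibits M on both sides.
  crossing-balance : ∀ X Y → Independent G X → CriticalIndependent G Y →
    ∣ X ∩ N G Y ∣ + ∣ N G Y ─ N[ X ] ∣ ≤ ∣ Y ∩ N G X ∣ + ∣ Y ─ N[ X ] ∣
  crossing-balance X Y indX critY = +-cancelˡ-≤ (∣ K ∣ + ∣ M ∣) _ _ (begin
      ∣ K ∣ + ∣ M ∣ + (∣ X ∩ N G Y ∣ + ∣ N G Y ─ N[ X ] ∣)    ≡⟨ interchange (∣ K ∣) (∣ M ∣) (∣ X ∩ N G Y ∣) _ ⟩
      ∣ K ∣ + (∣ X ∩ N G Y ∣ + (∣ M ∣ + ∣ N G Y ─ N[ X ] ∣))  ≡⟨ cong (∣ K ∣ +_) split-NY ⟩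
      ∣ K ∣ + ∣ N G Y ∣                                       ≤⟨ critical⇒≤ critY K-independent ⟩
      ∣ Y ∣ + ∣ N G K ∣                                       ≤⟨ +-mono-≤ Y-bound (p⊆q⇒∣p∣≤∣q∣ NK⊆M) ⟩
      ∣ K ∣ + (∣ Y ∩ N G X ∣ + ∣ Y ─ N[ X ] ∣) + ∣ M ∣          ≡⟨ swap₂₃ (∣ K ∣) _ _ ⟩
      ∣ K ∣ + ∣ M ∣ + (∣ Y ∩ N G X ∣ + ∣ Y ─ N[ X ] ∣)          ∎)
    where
    open ≤-Reasoning
    K M : Subset n
    K = Y ∩ X
    M = (N G Y ─ X) ∩ N G X
    K-independent : Independent G K
    K-independent = independent-⊆ (p∩q⊆p Y X) (proj₁ critY)
    NK⊆M : N G K ⊆ M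
    NK⊆M v∈NK with N-elim v∈NK
    ... | u , u∈K , uv with x∈p∩q⁻ Y X u∈K
    ...   | u∈Y , u∈X = x∈p∩q⁺ (x∈p∧x∉q⇒x∈p─q (N-intro u∈Y uv) (λ v∈X → indX _ _ u∈X v∈X uv)
                               , N-intro u∈X uv)
    split-NY : ∣ X ∩ N G Y ∣ + (∣ M ∣ + ∣ N G Y ─ N[ X ] ∣) ≡ ∣ N G Y ∣
    split-NY = sym (trans (∣p∣≡∣p∩q∣+∣p─q∩r∣+∣p─q∪r∣ (N G Y) X (N G X))
                          (cong (λ s → ∣ s ∣ + (∣ M ∣ + ∣ N G Y ─ N[ X ] ∣)) (∩-comm (N G Y) X)))
    rest⊆ : (Y ─ X) ∩ N G X ⊆ Y ∩ N G X
    rest⊆ x∈ with x∈p∩q⁻ (Y ─ X) (N G X) x∈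
    ... | x∈Y─X , x∈NX = x∈p∩q⁺ (p─q⊆p Y X x∈Y─X , x∈NX)
    Y-bound : ∣ Y ∣ ≤ ∣ K ∣ + (∣ Y ∩ N G X ∣ + ∣ Y ─ N[ X ] ∣)
    Y-bound = subst (_≤ ∣ K ∣ + (∣ Y ∩ N G X ∣ + ∣ Y ─ N[ X ] ∣))
      (sym (∣p∣≡∣p∩q∣+∣p─q∩r∣+∣p─q∪r∣ Y X (N G X)))
      (+-monoʳ-≤ (∣ K ∣) (+-monoˡ-≤ (∣ Y ─ N[ X ] ∣) (p⊆q⇒∣p∣≤∣q∣ rest⊆)))
    interchange : ∀ a b c d → a + b + (c + d) ≡ a + (c + (b + d))
    interchange = ℕ-Ring.solve-∀
    swap₂₃ : ∀ a b c → a + b + c ≡ a + c + b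
    swap₂₃ = ℕ-Ring.solve-∀

  extend : Subset n → Subset n → Subset n
  extend X Y = X ∪ (Y ─ N[ X ])

  extend-independent : ∀ X Y → Independent G X → Independent G Y → Independent G (extend X Y)
  extend-independent X Y indX indY u v u∈I v∈I uv
    with x∈p∪q⁻ X (Y ─ N[ X ]) u∈I | x∈p∪q⁻ X (Y ─ N[ X ]) v∈I
  ... | inj₁ u∈X  | inj₁ v∈X  = indX u v u∈X v∈X uv
  ... | inj₁ u∈X  | inj₂ v∈Y′ = ∉N[]⇒non-adjacent (proj₂ (x∈p─q⁻ Y N[ X ] v∈Y′)) u∈X (adj-sym uv)
  ... | inj₂ u∈Y′ | inj₁ v∈X  = ∉N[]⇒non-adjacent (proj₂ (x∈p─q⁻ Y N[ X ] u∈Y′)) v∈X uv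
  ... | inj₂ u∈Y′ | inj₂ v∈Y′ =
    indY u v (proj₁ (x∈p─q⁻ Y N[ X ] u∈Y′)) (proj₁ (x∈p─q⁻ Y N[ X ] v∈Y′)) uv

  N-extend⊆ : ∀ X Y → N G (extend X Y) ⊆ N G X ∪ (N G Y ─ N[ X ])
  N-extend⊆ X Y {v} v∈NI with N-elim v∈NI
  ... | u , u∈I , uv with x∈p∪q⁻ X (Y ─ N[ X ]) u∈I | v ∈? N G X
  ... | inj₁ u∈X  | _        = x∈p∪q⁺ (inj₁ (N-intro u∈X uv))
  ... | inj₂ _    | yes v∈NX = x∈p∪q⁺ (inj₁ v∈NX)
  ... | inj₂ u∈Y′ | no  v∉NX with x∈p─q⁻ Y N[ X ] u∈Y′
  ...   | u∈Y , u∉N[X] = x∈p∪q⁺ (inj₂ (x∈p∧x∉q⇒x∈p─q (N-intro u∈Y uv) v∉N[X]))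
    where
    v∉N[X] : v ∉ N[ X ]
    v∉N[X] v∈N[X] with x∈p∪q⁻ X (N G X) v∈N[X]
    ... | inj₁ v∈X  = ∉N[]⇒non-adjacent u∉N[X] v∈X uv
    ... | inj₂ v∈NX = v∉NX v∈NX

  extend-diff : ∀ X Y → ∣ N G Y ─ N[ X ] ∣ ≤ ∣ Y ─ N[ X ] ∣ → diff G X ℤ.≤ diff G (extend X Y)
  extend-diff X Y small =
    Equivalence.from (ℕ-diff-≤⇔ (∣ X ∣) (∣ N G X ∣) (∣ I ∣) (∣ N G I ∣)) (begin
      ∣ X ∣ + ∣ N G I ∣                      ≤⟨ +-monoʳ-≤ (∣ X ∣) NI-bound ⟩
      ∣ X ∣ + (∣ N G X ∣ + ∣ Y ─ N[ X ] ∣)  ≡⟨ swap₂₃ (∣ X ∣) _ _ ⟩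
      ∣ X ∣ + ∣ Y ─ N[ X ] ∣ + ∣ N G X ∣    ≤⟨ +-monoˡ-≤ (∣ N G X ∣) I-size ⟩
      ∣ I ∣ + ∣ N G X ∣                      ∎)
    where
    open ≤-Reasoning
    I : Subset n
    I = extend X Y
    NI-bound : ∣ N G I ∣ ≤ ∣ N G X ∣ + ∣ Y ─ N[ X ] ∣
    NI-bound = begin
      ∣ N G I ∣                             ≤⟨ p⊆q⇒∣p∣≤∣q∣ (N-extend⊆ X Y) ⟩
      ∣ N G X ∪ (N G Y ─ N[ X ]) ∣          ≤⟨ ∣p∪q∣≤∣p∣+∣q∣ (N G X) (N G Y ─ N[ X ]) ⟩
      ∣ N G X ∣ + ∣ N G Y ─ N[ X ] ∣        ≤⟨ +-monoʳ-≤ (∣ N G X ∣) small ⟩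
      ∣ N G X ∣ + ∣ Y ─ N[ X ] ∣            ∎
    I-size : ∣ X ∣ + ∣ Y ─ N[ X ] ∣ ≤ ∣ I ∣
    I-size = disjoint⇒∣p∣+∣q∣≤∣p∪q∣ X (Y ─ N[ X ])
      (λ x∈Y′ x∈X → proj₂ (x∈p─q⁻ Y N[ X ] x∈Y′) (x∈p∪q⁺ (inj₁ x∈X)))
    swap₂₃ : ∀ a b c → a + (b + c) ≡ a + c + b
    swap₂₃ = ℕ-Ring.solve-∀

lemma2p3 : ∀ {n} (G : SimpleGraph n) (Ic Jc : Subset n) →
    CriticalIndependent G Ic → CriticalIndependent G Jc →
    let J = Jc ─ (Ic ∪ N G Ic) in
    let I = Ic ∪ J in
    (∣ Ic ∩ N G Jc ∣ ≡ ∣ Jc ∩ N G Ic ∣)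
      × (∣ J ∣ ≥ ∣ N G Jc ─ (Ic ∪ N G Ic) ∣)
      × CriticalIndependent G I
lemma2p3 G Ic Jc critI@(indI , maximalI) critJ@(indJ , _) = balance , growth , I-critical
  where
  balance : ∣ Ic ∩ N G Jc ∣ ≡ ∣ Jc ∩ N G Ic ∣
  balance = ≤-antisym (crossing-≤ G Ic Jc critJ) (crossing-≤ G Jc Ic critI)

  growth : ∣ N G Jc ─ (Ic ∪ N G Ic) ∣ ≤ ∣ Jc ─ (Ic ∪ N G Ic) ∣
  growth = +-cancelˡ-≤ (∣ Ic ∩ N G Jc ∣) _ _
    (subst (λ k → ∣ Ic ∩ N G Jc ∣ + ∣ N G Jc ─ (Ic ∪ N G Ic) ∣ ≤ k + ∣ Jc ─ (Ic ∪ N G Ic) ∣)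
           (sym balance) (crossing-balance G Ic Jc indI critJ))

  I-critical : CriticalIndependent G (extend G Ic Jc)
  I-critical = extend-independent G Ic Jc indI indJ
             , λ L indL → ℤ.≤-trans (maximalI L indL) (extend-diff G Ic Jc growth)
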